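{- Let $n>0$ with $n\equiv1\pmod 4$. Then $\varphi(t^{4n-3})=w^{10n-9}$, $\varphi(t^{4n-1})=w^{10n-7}$, $\varphi(t^{4n+1})=w^{10n-3}$, and $\varphi(t^{4n+5})=w^{10n-1}$.
   Context: Let $V=t\,\mathbb{Z}/2[t^2]$ and let $V'\subset\mathbb{Z}/2[w]$ be spanned by the $w^k$ with $k\equiv1,3,7,9\pmod{20}$. $\varphi:V\to V'$ is the $\mathbb{Z}/2$-linear map with $\varphi(t),\varphi(t^3),\varphi(t^5),\varphi(t^9)=w,w^3,w^7,w^9$; $\varphi(t^7),\varphi(t^{11}),\varphi(t^{13}),\varphi(t^{15})=w^{21},w^{27},w^{23},w^{29}$; and $\varphi(t^{16}f)=w^{40}\varphi(f)$ for $f\in V$. -}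

module Defs where

open import Data.Nat using (ℕ; _+_; _*_)
open import Data.Nat.DivMod using (_/_; _%_)

-- Z/2-linear map φ : V = t Z/2[t^2] → V' ⊆ Z/2[w] sends monomials to monomials,
-- so it is determined by the exponent map on odd exponents:
--   φ(t^e) = w^(φExp e)   for e odd.
φBase : ℕ → ℕ
φBase 1  = 1
φBase 3  = 3
φBase 5  = 7
φBase 9  = 9
φBase 7  = 21
φBase 11 = 27
φBase 13 = 23
φBase 15 = 29
φBase _  = 0   -- even residues: not in V, never used

-- φ(t^(16 q + r)) = w^(40 q) φ(t^r)  (iterating φ(t^16 f) = w^40 φ(f))
φExp : ℕ → ℕ
φExp e = 40 * (e / 16) + φBase (e % 16)

module Submission where

open import Defs
open import Data.Nat using (ℕ; _+_; _*_; _∸_; _<_; _<?_; _/_)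
open import Data.Nat.DivMod
  using (_%_; +-distrib-/-∣ʳ; %-remove-+ʳ; m<n⇒m/n≡0; m<n⇒m%n≡m; m*n/n≡m; m≡m%n+[m/n]*n)
open import Data.Nat.Divisibility using (n∣m*n)
open import Data.Nat.Tactic.RingSolver using (solve-∀)
open import Data.Product using (_×_; _,_)
open import Relation.Nullary.Decidable using (from-yes)
open import Relation.Binary.PropositionalEquality using (_≡_; sym; trans; cong; cong₂; subst; module ≡-Reasoning)

-- Writing n = 4k + 1, the four exponents 4n - 3, 4n - 1, 4n + 1, 4n + 5 are 16k + r
-- for r = 1, 3, 5, 9, so φ sends them to 40k + φBase r = 40k + 1, 3, 7, 9, which are
-- exactly 10n - 9, 10n - 7, 10n - 3, 10n - 1.

φExp-+-*16 : ∀ r q → r < 16 → φExp (r + q * 16) ≡ φBase r + q * 40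
φExp-+-*16 r q r<16 = begin
  40 * ((r + q * 16) / 16) + φBase ((r + q * 16) % 16)
    ≡⟨ cong₂ (λ a b → 40 * a + φBase b) quotient remainder ⟩
  40 * q + φBase r
    ≡⟨ swap (φBase r) q ⟩
  φBase r + q * 40 ∎
  where
  open ≡-Reasoning

  quotient : (r + q * 16) / 16 ≡ q
  quotient = begin
    (r + q * 16) / 16      ≡⟨ +-distrib-/-∣ʳ r (n∣m*n q) ⟩
    r / 16 + q * 16 / 16   ≡⟨ cong₂ _+_ (m<n⇒m/n≡0 r<16) (m*n/n≡m q 16) ⟩
    q                      ∎

  remainder : (r + q * 16) % 16 ≡ r
  remainder = trans (%-remove-+ʳ r (n∣m*n q)) (m<n⇒m%n≡m r<16)

  swap : ∀ a q → 40 * q + a ≡ a + q * 40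
  swap = solve-∀

Lemma6p1-identities : ℕ → Set
Lemma6p1-identities n =
  (φExp (4 * n ∸ 3) ≡ 10 * n ∸ 9) × (φExp (4 * n ∸ 1) ≡ 10 * n ∸ 7) ×
  (φExp (4 * n + 1) ≡ 10 * n ∸ 3) × (φExp (4 * n + 5) ≡ 10 * n ∸ 1)

-- With the constant in front, (c + x) ∸ d reduces to (c ∸ d) + x for literals c ≥ d,
-- so e.g. (4 + k * 16) ∸ 3 is definitionally 1 + k * 16.
lemma6p1-identities-4k+1 : ∀ k → Lemma6p1-identities (1 + k * 4)
lemma6p1-identities-4k+1 k =
  φExp-at 1 (from-yes (1 <? 16)) (cong (_∸ 3) (4n k)) (cong (_∸ 9) (10n k)) ,
  φExp-at 3 (from-yes (3 <? 16)) (cong (_∸ 1) (4n k)) (cong (_∸ 7) (10n k)) ,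
  φExp-at 5 (from-yes (5 <? 16)) (4n+1 k)             (cong (_∸ 3) (10n k)) ,
  φExp-at 9 (from-yes (9 <? 16)) (4n+5 k)             (cong (_∸ 1) (10n k))
  where
  4n : ∀ j → 4 * (1 + j * 4) ≡ 4 + j * 16
  4n = solve-∀
  4n+1 : ∀ j → 4 * (1 + j * 4) + 1 ≡ 5 + j * 16
  4n+1 = solve-∀
  4n+5 : ∀ j → 4 * (1 + j * 4) + 5 ≡ 9 + j * 16
  4n+5 = solve-∀
  10n : ∀ j → 10 * (1 + j * 4) ≡ 10 + j * 40
  10n = solve-∀

  φExp-at : ∀ r {e m} → r < 16 → e ≡ r + k * 16 → m ≡ φBase r + k * 40 → φExp e ≡ m
  φExp-at r r<16 e≡ m≡ = trans (cong φExp e≡) (trans (φExp-+-*16 r k r<16) (sym m≡))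

-- The hypothesis 0 < n is implied by n % 4 ≡ 1 and not needed.
lemma6p1 : (n : ℕ) → 0 < n → n % 4 ≡ 1 →
    (φExp (4 * n ∸ 3) ≡ 10 * n ∸ 9) × (φExp (4 * n ∸ 1) ≡ 10 * n ∸ 7) ×
    (φExp (4 * n + 1) ≡ 10 * n ∸ 3) × (φExp (4 * n + 5) ≡ 10 * n ∸ 1)
lemma6p1 n _ n%4≡1 = subst Lemma6p1-identities (sym n≡1+[n/4]*4) (lemma6p1-identities-4k+1 (n / 4))
  where
  n≡1+[n/4]*4 : n ≡ 1 + n / 4 * 4
  n≡1+[n/4]*4 = trans (m≡m%n+[m/n]*n n 4) (cong (_+ n / 4 * 4) n%4≡1)
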